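{- For every positive integer $n$, let \[ V_n = 1^2 + 2^2 + \cdots + n^2 = \frac{n(n+1)(2n+1)}{6}. \] Then the following hold. (i) For every positive integer $n$, $V_n \not\equiv E \pmod{10}$ for each $E \in \{2, 3, 7, 8\}$. That is, in base ten the units digit of $V_n$ is never $2$, $3$, $7$ or $8$. (ii) For every $E \in \{0, 1, 2, 3, 4, 5, 6, 7\}$ there exists a positive integer $n$ with $V_n \equiv E \pmod{8}$. That is, in base eight every digit occurs as the units digit of some $V_n$.
   Context: $V_n$ is the minor total (partial sum) of the sequence of squares $1^2, 2^2, 3^2, \dots$, i.e., the Faulhaber sum $\sum_{k=1}^n k^p$ with $p = 2$. -}

module Defs where

open import Data.Nat using (ℕ; zero; suc; _+_; _*_)

V : ℕ → ℕ
V zero    = 0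
V (suc n) = V n + suc n * suc n

{-# OPTIONS --safe #-}
module Submission where

-- Shifting the range of summation gives V (m + n) = V m + n m² + m n (n + 1) + V n,
-- so V (n + p) ≡ V n (mod d) whenever d divides both p and V p.  For d = 10 the
-- period p = 20 qualifies (V 20 = 2870), which reduces (i) to the twenty values
-- V 0, …, V 19; (ii) is witnessed by small n.

open import Defs
open import Data.Nat using (ℕ; zero; suc; _+_; _*_; _%_; _/_; _<_; _≥_; _≟_; s≤s; z≤n; NonZero)
open import Data.Nat.Properties using (+-suc; +-assoc; +-comm; +-identityʳ; allUpTo?)
open import Data.Nat.DivMod using (m≡m%n+[m/n]*n; m%n<n; %-remove-+ʳ)
open import Data.Nat.Divisibility using (_∣_; divides; ∣-trans; m∣m*n; ∣m∣n⇒∣m+n)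
open import Data.Nat.Tactic.RingSolver using (solve-∀)
open import Data.Product using (_×_; ∃-syntax; _,_)
open import Data.Sum using (_⊎_)
open import Relation.Nullary using (¬_; ¬?)
open import Relation.Nullary.Decidable using (_⊎-dec_; from-yes)
open import Relation.Binary.PropositionalEquality using (_≡_; _≢_; refl; sym; trans; cong; subst; module ≡-Reasoning)

V-+ : ∀ m n → V (m + n) ≡ V m + n * (m * m + m * suc n) + V n
V-+ m zero    = trans (cong V (+-identityʳ m)) (sym (trans (+-identityʳ (V m + 0)) (+-identityʳ (V m))))
V-+ m (suc n) = begin
  V (m + suc n)                                            ≡⟨ cong V (+-suc m n) ⟩
  V (m + n) + suc (m + n) * suc (m + n)                    ≡⟨ cong (λ x → x + suc (m + n) * suc (m + n)) (V-+ m n) ⟩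
  V m + n * (m * m + m * suc n) + V n + suc (m + n) * suc (m + n)
                                                           ≡⟨ regroup (V m) (V n) m n ⟩
  V m + suc n * (m * m + m * suc (suc n)) + (V n + suc n * suc n) ∎
  where
  open ≡-Reasoning
  regroup : ∀ a b m n → a + n * (m * m + m * suc n) + b + suc (m + n) * suc (m + n)
                      ≡ a + suc n * (m * m + m * suc (suc n)) + (b + suc n * suc n)
  regroup = solve-∀

V-periodic-mod : ∀ {d p} .{{_ : NonZero d}} → d ∣ p → d ∣ V p → ∀ n → V (n + p) % d ≡ V n % d
V-periodic-mod {d} {p} d∣p d∣Vp n = begin
  V (n + p) % d                                   ≡⟨ cong (_% d) (V-+ n p) ⟩
  (V n + p * (n * n + n * suc p) + V p) % d       ≡⟨ cong (_% d) (+-assoc (V n) _ (V p)) ⟩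
  (V n + (p * (n * n + n * suc p) + V p)) % d     ≡⟨ %-remove-+ʳ (V n) (∣m∣n⇒∣m+n (∣-trans d∣p (m∣m*n _)) d∣Vp) ⟩
  V n % d ∎
  where open ≡-Reasoning

periodic⇒≡-at-% : ∀ {A : Set} (f : ℕ → A) {p} .{{_ : NonZero p}} →
                  (∀ n → f (n + p) ≡ f n) → ∀ n → f n ≡ f (n % p)
periodic⇒≡-at-% f {p} f-periodic n =
  subst (λ m → f m ≡ f (n % p)) (sym (m≡m%n+[m/n]*n n p)) (shifts (n / p))
  where
  open ≡-Reasoning
  shifts : ∀ q → f (n % p + q * p) ≡ f (n % p)
  shifts zero    = cong f (+-comm (n % p) 0)
  shifts (suc q) = begin
    f (n % p + (p + q * p)) ≡⟨ cong f (+-comm (n % p) (p + q * p)) ⟩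
    f (p + q * p + n % p)   ≡⟨ cong f (+-assoc p (q * p) (n % p)) ⟩
    f (p + (q * p + n % p)) ≡⟨ cong f (+-comm p (q * p + n % p)) ⟩
    f (q * p + n % p + p)   ≡⟨ f-periodic (q * p + n % p) ⟩
    f (q * p + n % p)       ≡⟨ cong f (+-comm (q * p) (n % p)) ⟩
    f (n % p + q * p)       ≡⟨ shifts q ⟩
    f (n % p) ∎

Is2378 : ℕ → Set
Is2378 d = d ≡ 2 ⊎ d ≡ 3 ⊎ d ≡ 7 ⊎ d ≡ 8

V-units-digit-upTo-20 : ∀ {r} → r < 20 → ¬ Is2378 (V r % 10)
V-units-digit-upTo-20 = from-yes
  (allUpTo? (λ r → let d = V r % 10 in ¬? (d ≟ 2 ⊎-dec d ≟ 3 ⊎-dec d ≟ 7 ⊎-dec d ≟ 8)) 20)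

V-units-digit : ∀ n → ¬ Is2378 (V n % 10)
V-units-digit n = subst (λ d → ¬ Is2378 d) (sym (periodic⇒≡-at-% (λ m → V m % 10) V-periodic-mod-10 n))
  (V-units-digit-upTo-20 (m%n<n n 20))
  where
  V-periodic-mod-10 : ∀ n → V (n + 20) % 10 ≡ V n % 10
  V-periodic-mod-10 = V-periodic-mod (divides 2 refl) (divides 287 refl)

proposition6 : ((n : ℕ) → n ≥ 1 → (E : ℕ) → (E ≡ 2 ⊎ E ≡ 3 ⊎ E ≡ 7 ⊎ E ≡ 8) → V n % 10 ≢ E)
    × ((E : ℕ) → E < 8 → ∃[ n ] (n ≥ 1 × V n % 8 ≡ E))
proposition6 = (λ n _ E hE eq → V-units-digit n (subst Is2378 (sym eq) hE)) , octal-digit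
  where
  octal-digit : (E : ℕ) → E < 8 → ∃[ n ] (n ≥ 1 × V n % 8 ≡ E)
  octal-digit 0 _ = 15 , s≤s z≤n , refl
  octal-digit 1 _ = 1  , s≤s z≤n , refl
  octal-digit 2 _ = 11 , s≤s z≤n , refl
  octal-digit 3 _ = 6  , s≤s z≤n , refl
  octal-digit 4 _ = 7  , s≤s z≤n , refl
  octal-digit 5 _ = 2  , s≤s z≤n , refl
  octal-digit 6 _ = 3  , s≤s z≤n , refl
  octal-digit 7 _ = 5  , s≤s z≤n , refl
  octal-digit (suc (suc (suc (suc (suc (suc (suc (suc _)))))))) (s≤s (s≤s (s≤s (s≤s (s≤s (s≤s (s≤s (s≤s ()))))))))
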